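{- Let $p$ be a prime, $q=p^a$, $A=\{\mathbf a_1,\dots,\mathbf a_N\}\subseteq\mathbb Z^n$, and let $M\subseteq\mathbb Z^n$ satisfy: for every $\mathbf a\in M$ and every expression $\mathbf a=\sum_{i=1}^Nc_i\mathbf a_i$ with $c_i\in\mathbb N$, if $c_{i_0}\ge q$ for some $i_0$ then $\mathbf a-(q-1)\mathbf a_{i_0}\in M$. Assume $U_M\neq\emptyset$. Let $u\in U_{M,\min}$, write $u_i=\sum_{k=0}^{a-1}u^{(k)}_ip^k$ with $u^{(k)}_i\in\{0,\dots,p-1\}$, put $u^{(k)}=(u^{(k)}_1,\dots,u^{(k)}_N)$ and $\gamma_k=\sum_{i=1}^Nu^{(k)}_i\mathbf a_i$ for $k=0,\dots,a-1$. Then for each $k=0,\dots,a-1$, $\gamma_k$ is good and $u^{(k)}\in U^+_{\min}(\gamma_k)$.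
   Context: $\mathbb N=\{0,1,\dots\}$, $\mathbb NA=\{\sum_ic_i\mathbf a_i:c_i\in\mathbb N\}$. For $\gamma\in\mathbb NA$: $U^+(\gamma)=\{u\in\mathbb N^N:\sum_iu_i\mathbf a_i=\gamma\}$, $w(\gamma)=\min\{\sum_iu_i:u\in U^+(\gamma)\}$, $U^+_{\min}(\gamma)=\{u\in U^+(\gamma):\sum_iu_i=w(\gamma)\}$; $\gamma$ is good if every $u\in U^+_{\min}(\gamma)$ has all $u_i\le p-1$. Let $U^+_{q-1}=\{u\in\mathbb Z^N:0\le u_i\le q-1\ \forall i\}$. For $u\in U^+_{q-1}$ with base-$p$ digits $u_i=\sum_{k=0}^{a-1}u^{(k)}_ip^k$ ($0\le u^{(k)}_i\le p-1$), the $p$-weight is $w_p(u)=\sum_{i=1}^N\sum_{k=0}^{a-1}u^{(k)}_i$. $U_M=\{u\in U^+_{q-1}:\sum_iu_i\mathbf a_i\in M\}$, $w_p(M)=\min\{w_p(u):u\in U_M\}$, $U_{M,\min}=\{u\in U_M:w_p(u)=w_p(M)\}$. -}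

module Defs where

open import Data.Nat using (ℕ; zero; suc; _+_; _∸_; _^_; _≤_; _/_; _%_)
open import Data.Nat.Properties using (m^n≢0)
open import Data.Integer as ℤ using (ℤ; +_)
open import Data.Fin using (Fin; zero; suc)
open import Data.Vec using (Vec; tabulate; lookup)
open import Data.Product using (Σ; ∃; _×_)
open import Relation.Binary.PropositionalEquality using (_≡_)

∑ : ∀ {N} → (Fin N → ℕ) → ℕ
∑ {zero}  f = 0
∑ {suc N} f = f zero + ∑ (λ i → f (suc i))

∑ℤ : ∀ {N} → (Fin N → ℤ) → ℤ
∑ℤ {zero}  f = + 0
∑ℤ {suc N} f = f zero ℤ.+ ∑ℤ (λ i → f (suc i))

-- the base-p digit of x at position k:  x = Σ_k digit p k x * p^k
-- (p = 0 is a junk case; it never occurs since p is prime)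
digit : ℕ → ℕ → ℕ → ℕ
digit zero    k x = 0
digit (suc p) k x = ((_/_ x (suc p ^ k) {{m^n≢0 (suc p) k}})) % suc p

module _ {n N : ℕ} (A : Fin N → Vec ℤ n) where

  lin : (Fin N → ℕ) → Vec ℤ n
  lin c = tabulate (λ j → ∑ℤ (λ i → (+ c i) ℤ.* lookup (A i) j))

  InU⁺ : Vec ℤ n → (Fin N → ℕ) → Set
  InU⁺ γ u = lin u ≡ γ

  size : (Fin N → ℕ) → ℕ
  size u = ∑ u

  InU⁺min : Vec ℤ n → (Fin N → ℕ) → Set
  InU⁺min γ u = InU⁺ γ u × (∀ v → InU⁺ γ v → size u ≤ size v)

  Good : ℕ → Vec ℤ n → Set
  Good p γ = ∀ u → InU⁺min γ u → ∀ i → u i ≤ p ∸ 1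

  InBox : ℕ → (Fin N → ℕ) → Set
  InBox q u = ∀ i → u i ≤ q ∸ 1

  wp : ℕ → ℕ → (Fin N → ℕ) → ℕ
  wp p a u = ∑ (λ i → ∑ {a} (λ k → digit p (Data.Fin.toℕ k) (u i)))

  InUM : ℕ → ℕ → (Vec ℤ n → Set) → (Fin N → ℕ) → Set
  InUM p a M u = InBox (p ^ a) u × M (lin u)

  InUMmin : ℕ → ℕ → (Vec ℤ n → Set) → (Fin N → ℕ) → Set
  InUMmin p a M u = InUM p a M u × (∀ v → InUM p a M v → wp p a u ≤ wp p a v)

  MClosed : ℕ → (Vec ℤ n → Set) → Set
  MClosed q M = ∀ γ → M γ → ∀ c → lin c ≡ γ → ∀ i₀ → q ≤ c i₀ →
    M (tabulate (λ j → lookup γ j ℤ.- (+ (q ∸ 1)) ℤ.* lookup (A i₀) j))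

-- Write every coordinate of an exponent vector in base p as a row of digits at positions 0 … a - 1, but allow
-- digits ≥ p (tokens).  A carry turns p tokens at position k into one token at position k + 1,
-- or at position 0 when k is the top position, which lowers the coordinate by q - 1; it removes
-- p - 1 tokens, and the closure hypothesis on M is exactly what keeps the vector in M.  Carrying
-- until all digits are < p turns any token array whose vector lies in M into an element of U_M
-- of p-weight at most the number of tokens, and strictly less if some digit was ≥ p.
-- Now replace the digit column u^(k) of u by any v ∈ U⁺(γ_k): the vector Σ u_i a_i is unchanged,
-- and the number of tokens changes by Σ v - Σ u^(k).  Minimality of w_p(u) gives Σ u^(k) ≤ Σ v,
-- and a minimal v with an entry ≥ p would produce an element of U_M of smaller p-weight than u.

module Submission where

open import Defs
import Algebra.Properties.AbelianGroup as AbelianGroup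
import Algebra.Properties.CommutativeSemigroup as CommutativeSemigroup
open import Data.Empty using (⊥-elim)
open import Data.Fin using (Fin; zero; suc; toℕ; fromℕ<)
import Data.Fin.Properties as Fin
open import Data.Fin.Properties using (toℕ<n; toℕ-fromℕ<; any?)
open import Data.Integer as ℤ using (ℤ)
import Data.Integer.Properties as ℤ
open import Data.Nat using (ℕ; zero; suc; _+_; _*_; _∸_; _^_; _≤_; _<_; z≤n; s≤s)
open import Data.Nat.Divisibility using (n∣m*n)
open import Data.Nat.DivMod
open import Data.Nat.Induction using (<-wellFounded)
open import Data.Nat.Primality using (Prime; ¬prime[0]; ¬prime[1])
open import Data.Nat.Properties
open import Data.Product using (∃; _×_; _,_; proj₁; proj₂)
open import Data.Sum using (_⊎_; inj₁; inj₂)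
open import Data.Vec using (Vec; tabulate; lookup)
open import Data.Vec.Properties using (lookup∘tabulate; tabulate-cong)
open import Data.Vec.Functional using (updateAt)
open import Data.Vec.Functional.Properties using (updateAt-updates; updateAt-minimal; updateAt-id; map-updateAt-local)
open import Function using (_∘_)
open import Induction.WellFounded using (Acc; acc)
open import Relation.Binary.PropositionalEquality
open import Relation.Nullary using (yes; no; contradiction)

private
  module ℕ+ = CommutativeSemigroup +-commutativeSemigroup
  module ℕ* = CommutativeSemigroup *-commutativeSemigroup
  module ℤ+ = CommutativeSemigroup ℤ.+-commutativeSemigroup
  module ℤ* = CommutativeSemigroup ℤ.*-commutativeSemigroup
  module ℤ-+ = AbelianGroup ℤ.+-0-abelianGroup

∑-cong : ∀ {N} {f g : Fin N → ℕ} → (∀ i → f i ≡ g i) → ∑ f ≡ ∑ g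
∑-cong {zero}  e = refl
∑-cong {suc N} e = cong₂ _+_ (e zero) (∑-cong (λ i → e (suc i)))

∑-mono-≤ : ∀ {N} {f g : Fin N → ℕ} → (∀ i → f i ≤ g i) → ∑ f ≤ ∑ g
∑-mono-≤ {zero}  e = z≤n
∑-mono-≤ {suc N} e = +-mono-≤ (e zero) (∑-mono-≤ (λ i → e (suc i)))

∑-distrib-+ : ∀ {N} (f g : Fin N → ℕ) → ∑ (λ i → f i + g i) ≡ ∑ f + ∑ g
∑-distrib-+ {zero}  f g = refl
∑-distrib-+ {suc N} f g = begin
  (f zero + g zero) + ∑ (λ i → f (suc i) + g (suc i))
    ≡⟨ cong ((f zero + g zero) +_) (∑-distrib-+ (λ i → f (suc i)) (λ i → g (suc i))) ⟩
  (f zero + g zero) + (∑ (λ i → f (suc i)) + ∑ (λ i → g (suc i)))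
    ≡⟨ ℕ+.interchange (f zero) (g zero) _ _ ⟩
  (f zero + ∑ (λ i → f (suc i))) + (g zero + ∑ (λ i → g (suc i))) ∎
  where open ≡-Reasoning

∑-*-distribʳ : ∀ {N} (f : Fin N → ℕ) m → ∑ (λ i → f i * m) ≡ ∑ f * m
∑-*-distribʳ {zero}  f m = refl
∑-*-distribʳ {suc N} f m =
  trans (cong (f zero * m +_) (∑-*-distribʳ (λ i → f (suc i)) m))
        (sym (*-distribʳ-+ m (f zero) _))

∑-incr : ∀ {N} {f g : Fin N → ℕ} (i : Fin N) {m} →
         (∀ j → j ≢ i → f j ≡ g j) → f i ≡ m + g i → ∑ f ≡ m + ∑ g
∑-incr {suc N} {f} {g} zero {m} agree fi = begin
  f zero + ∑ (λ j → f (suc j)) ≡⟨ cong₂ _+_ fi (∑-cong (λ j → agree (suc j) (λ ()))) ⟩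
  (m + g zero) + ∑ (λ j → g (suc j)) ≡⟨ +-assoc m (g zero) _ ⟩
  m + ∑ g ∎
  where open ≡-Reasoning
∑-incr {suc N} {f} {g} (suc i) {m} agree fi = begin
  f zero + ∑ (λ j → f (suc j))
    ≡⟨ cong₂ _+_ (agree zero (λ ())) (∑-incr i (λ j j≢i → agree (suc j) (j≢i ∘ Fin.suc-injective)) fi) ⟩
  g zero + (m + ∑ (λ j → g (suc j))) ≡⟨ ℕ+.x∙yz≈y∙xz (g zero) m _ ⟩
  m + ∑ g ∎
  where open ≡-Reasoning

∑-updateAt-∸ : ∀ {N} (f : Fin N → ℕ) i {m} → m ≤ f i → ∑ f ≡ m + ∑ (updateAt f i (_∸ m))
∑-updateAt-∸ f i {m} m≤fi = ∑-incr i (λ j j≢i → sym (updateAt-minimal j i f j≢i))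
  (trans (sym (m+[n∸m]≡n m≤fi)) (cong (m +_) (sym (updateAt-updates i f))))

∑-updateAt-suc : ∀ {N} (f : Fin N → ℕ) i → ∑ (updateAt f i suc) ≡ suc (∑ f)
∑-updateAt-suc f i = ∑-incr i (λ j j≢i → updateAt-minimal j i f j≢i) (updateAt-updates i f)

∑ℤ-cong : ∀ {N} {f g : Fin N → ℤ} → (∀ i → f i ≡ g i) → ∑ℤ f ≡ ∑ℤ g
∑ℤ-cong {zero}  e = refl
∑ℤ-cong {suc N} e = cong₂ ℤ._+_ (e zero) (∑ℤ-cong (λ i → e (suc i)))

∑ℤ-distrib-+ : ∀ {N} (f g : Fin N → ℤ) → ∑ℤ (λ i → f i ℤ.+ g i) ≡ ∑ℤ f ℤ.+ ∑ℤ g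
∑ℤ-distrib-+ {zero}  f g = refl
∑ℤ-distrib-+ {suc N} f g =
  trans (cong (ℤ._+_ (f zero ℤ.+ g zero)) (∑ℤ-distrib-+ (λ i → f (suc i)) (λ i → g (suc i))))
        (ℤ+.interchange (f zero) (g zero) _ _)

∑ℤ-*-distribʳ : ∀ {N} (f : Fin N → ℤ) m → ∑ℤ (λ i → f i ℤ.* m) ≡ ∑ℤ f ℤ.* m
∑ℤ-*-distribʳ {zero}  f m = sym (ℤ.*-zeroˡ m)
∑ℤ-*-distribʳ {suc N} f m =
  trans (cong (ℤ._+_ (f zero ℤ.* m)) (∑ℤ-*-distribʳ (λ i → f (suc i)) m))
        (sym (ℤ.*-distribʳ-+ m (f zero) (∑ℤ (λ i → f (suc i)))))

∑ℤ-incr : ∀ {N} {f g : Fin N → ℤ} (i : Fin N) {m} →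
          (∀ j → j ≢ i → f j ≡ g j) → f i ≡ m ℤ.+ g i → ∑ℤ f ≡ m ℤ.+ ∑ℤ g
∑ℤ-incr {suc N} {f} {g} zero {m} agree fi =
  trans (cong₂ ℤ._+_ fi (∑ℤ-cong (λ j → agree (suc j) (λ ())))) (ℤ.+-assoc m (g zero) _)
∑ℤ-incr {suc N} {f} {g} (suc i) {m} agree fi =
  trans (cong₂ ℤ._+_ (agree zero (λ ())) (∑ℤ-incr i {m} (λ j j≢i → agree (suc j) (j≢i ∘ Fin.suc-injective)) fi))
        (ℤ+.x∙yz≈y∙xz (g zero) m _)

module _ {n N : ℕ} (A : Fin N → Vec ℤ n) where

  linAt : (Fin N → ℕ) → Fin n → ℤ
  linAt c j = ∑ℤ (λ i → ℤ.+ c i ℤ.* lookup (A i) j)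

  lookup-lin : ∀ c j → lookup (lin A c) j ≡ linAt c j
  lookup-lin c j = lookup∘tabulate (linAt c) j

  lin-cong : ∀ {c c′} → (∀ i → c i ≡ c′ i) → lin A c ≡ lin A c′
  lin-cong e = tabulate-cong (λ j → ∑ℤ-cong (λ i → cong (λ x → ℤ.+ x ℤ.* lookup (A i) j) (e i)))

  linAt-affine : ∀ m c e j → linAt (λ i → c i * m + e i) j ≡ linAt c j ℤ.* ℤ.+ m ℤ.+ linAt e j
  linAt-affine m c e j = begin
    ∑ℤ (λ i → ℤ.+ (c i * m + e i) ℤ.* a i)
      ≡⟨ ∑ℤ-cong summand ⟩
    ∑ℤ (λ i → ℤ.+ c i ℤ.* a i ℤ.* ℤ.+ m ℤ.+ ℤ.+ e i ℤ.* a i)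
      ≡⟨ ∑ℤ-distrib-+ (λ i → ℤ.+ c i ℤ.* a i ℤ.* ℤ.+ m) (λ i → ℤ.+ e i ℤ.* a i) ⟩
    ∑ℤ (λ i → ℤ.+ c i ℤ.* a i ℤ.* ℤ.+ m) ℤ.+ linAt e j
      ≡⟨ cong (ℤ._+ linAt e j) (∑ℤ-*-distribʳ (λ i → ℤ.+ c i ℤ.* a i) (ℤ.+ m)) ⟩
    linAt c j ℤ.* ℤ.+ m ℤ.+ linAt e j ∎
    where
    open ≡-Reasoning
    a : Fin N → ℤ
    a i = lookup (A i) j
    summand : ∀ i → ℤ.+ (c i * m + e i) ℤ.* a i ≡ ℤ.+ c i ℤ.* a i ℤ.* ℤ.+ m ℤ.+ ℤ.+ e i ℤ.* a i
    summand i = begin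
      ℤ.+ (c i * m + e i) ℤ.* a i
        ≡⟨ cong (ℤ._* a i) (ℤ.pos-+ (c i * m) (e i)) ⟩
      (ℤ.+ (c i * m) ℤ.+ ℤ.+ e i) ℤ.* a i
        ≡⟨ ℤ.*-distribʳ-+ (a i) (ℤ.+ (c i * m)) (ℤ.+ e i) ⟩
      ℤ.+ (c i * m) ℤ.* a i ℤ.+ ℤ.+ e i ℤ.* a i
        ≡⟨ cong (λ x → x ℤ.* a i ℤ.+ ℤ.+ e i ℤ.* a i) (ℤ.pos-* (c i) m) ⟩
      ℤ.+ c i ℤ.* ℤ.+ m ℤ.* a i ℤ.+ ℤ.+ e i ℤ.* a i
        ≡⟨ cong (ℤ._+ ℤ.+ e i ℤ.* a i) (ℤ*.xy∙z≈xz∙y (ℤ.+ c i) (ℤ.+ m) (a i)) ⟩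
      ℤ.+ c i ℤ.* a i ℤ.* ℤ.+ m ℤ.+ ℤ.+ e i ℤ.* a i ∎

  lin-affine-cong : ∀ m {c c′} e → lin A c ≡ lin A c′ →
                    lin A (λ i → c i * m + e i) ≡ lin A (λ i → c′ i * m + e i)
  lin-affine-cong m {c} {c′} e eq = tabulate-cong λ j → begin
    linAt (λ i → c i * m + e i) j       ≡⟨ linAt-affine m c e j ⟩
    linAt c j ℤ.* ℤ.+ m ℤ.+ linAt e j   ≡⟨ cong (λ x → x ℤ.* ℤ.+ m ℤ.+ linAt e j) (linAt-eq j) ⟩
    linAt c′ j ℤ.* ℤ.+ m ℤ.+ linAt e j  ≡⟨ linAt-affine m c′ e j ⟨
    linAt (λ i → c′ i * m + e i) j      ∎
    where
    open ≡-Reasoning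
    linAt-eq : ∀ j → linAt c j ≡ linAt c′ j
    linAt-eq j = trans (sym (lookup-lin c j)) (trans (cong (λ γ → lookup γ j) eq) (lookup-lin c′ j))

  lin-incr : ∀ {c c′} i {m} → (∀ k → k ≢ i → c k ≡ c′ k) → c i ≡ m + c′ i →
             tabulate (λ j → lookup (lin A c) j ℤ.- ℤ.+ m ℤ.* lookup (A i) j) ≡ lin A c′
  lin-incr {c} {c′} i {m} agree ci = tabulate-cong λ j → begin
    lookup (lin A c) j ℤ.- ℤ.+ m ℤ.* lookup (A i) j
      ≡⟨ cong (ℤ._- ℤ.+ m ℤ.* lookup (A i) j) (trans (lookup-lin c j) (linAt-incr j)) ⟩
    ℤ.+ m ℤ.* lookup (A i) j ℤ.+ linAt c′ j ℤ.- ℤ.+ m ℤ.* lookup (A i) j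
      ≡⟨ ℤ-+.xyx⁻¹≈y (ℤ.+ m ℤ.* lookup (A i) j) (linAt c′ j) ⟩
    linAt c′ j ∎
    where
    open ≡-Reasoning
    linAt-incr : ∀ j → linAt c j ≡ ℤ.+ m ℤ.* lookup (A i) j ℤ.+ linAt c′ j
    linAt-incr j = ∑ℤ-incr i {ℤ.+ m ℤ.* a}
      (λ k k≢i → cong (λ x → ℤ.+ x ℤ.* lookup (A k) j) (agree k k≢i))
      (begin
        ℤ.+ c i ℤ.* a                    ≡⟨ cong (λ x → ℤ.+ x ℤ.* a) ci ⟩
        ℤ.+ (m + c′ i) ℤ.* a             ≡⟨ cong (ℤ._* a) (ℤ.pos-+ m (c′ i)) ⟩
        (ℤ.+ m ℤ.+ ℤ.+ c′ i) ℤ.* a       ≡⟨ ℤ.*-distribʳ-+ a (ℤ.+ m) (ℤ.+ c′ i) ⟩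
        ℤ.+ m ℤ.* a ℤ.+ ℤ.+ c′ i ℤ.* a   ∎)
      where
      a = lookup (A i) j

-- The base is written suc p′ so that Defs.digit computes on it.
module Positional (p′ : ℕ) where

  p : ℕ
  p = suc p′

  value : ∀ {a} → (Fin a → ℕ) → ℕ
  value r = ∑ (λ k → r k * p ^ toℕ k)

  value-cong : ∀ {a} {r r′ : Fin a → ℕ} → (∀ k → r k ≡ r′ k) → value r ≡ value r′
  value-cong e = ∑-cong (λ k → cong (_* p ^ toℕ k) (e k))

  value-suc : ∀ {a} (r : Fin (suc a) → ℕ) → value r ≡ r zero + value (λ k → r (suc k)) * p
  value-suc r = cong₂ _+_ (*-identityʳ (r zero)) (begin
    ∑ (λ k → r (suc k) * (p * p ^ toℕ k))  ≡⟨ ∑-cong (λ k → ℕ*.x∙yz≈xz∙y (r (suc k)) p _) ⟩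
    ∑ (λ k → r (suc k) * p ^ toℕ k * p)    ≡⟨ ∑-*-distribʳ (λ k → r (suc k) * p ^ toℕ k) p ⟩
    value (λ k → r (suc k)) * p ∎)
    where open ≡-Reasoning

  value-< : ∀ {a} (r : Fin a → ℕ) → (∀ k → r k < p) → value r < p ^ a
  value-< {zero}  r r<p = s≤s z≤n
  value-< {suc a} r r<p = begin-strict
    value r                    ≡⟨ value-suc r ⟩
    r zero + V * p             <⟨ +-monoˡ-< (V * p) (r<p zero) ⟩
    suc V * p                  ≤⟨ *-monoˡ-≤ p (value-< (λ k → r (suc k)) (λ k → r<p (suc k))) ⟩
    p ^ a * p                  ≡⟨ *-comm (p ^ a) p ⟩
    p ^ suc a ∎
    where
    open ≤-Reasoning
    V = value (λ k → r (suc k))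

  value-incr : ∀ {a} {r r′ : Fin a → ℕ} k {m} → (∀ j → j ≢ k → r j ≡ r′ j) → r k ≡ m + r′ k →
               value r ≡ m * p ^ toℕ k + value r′
  value-incr {r′ = r′} k {m} agree rk = ∑-incr k (λ j j≢k → cong (_* p ^ toℕ j) (agree j j≢k))
    (trans (cong (_* p ^ toℕ k) rk) (*-distribʳ-+ (p ^ toℕ k) m (r′ k)))

  value-updateAt-∸ : ∀ {a} (r : Fin a → ℕ) k {m} → m ≤ r k →
                     value r ≡ m * p ^ toℕ k + value (updateAt r k (_∸ m))
  value-updateAt-∸ r k {m} m≤rk = value-incr k (λ j j≢k → sym (updateAt-minimal j k r j≢k))
    (trans (sym (m+[n∸m]≡n m≤rk)) (cong (m +_) (sym (updateAt-updates k r))))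

  value-updateAt-suc : ∀ {a} (r : Fin a → ℕ) k → value (updateAt r k suc) ≡ p ^ toℕ k + value r
  value-updateAt-suc r k =
    trans (value-incr k (λ j j≢k → updateAt-minimal j k r j≢k) (updateAt-updates k r))
          (cong (_+ value r) (*-identityˡ (p ^ toℕ k)))

  CarryStep : ∀ {a} → (Fin a → ℕ) → (Fin a → ℕ) → Set
  CarryStep {a} r r′ = ∑ r ≡ p′ + ∑ r′ ×
    (value r ≡ value r′ ⊎ value r ≡ (p ^ a ∸ 1) + value r′ × p ^ a ≤ value r)

  carry : ∀ {a} (r : Fin a → ℕ) k → p ≤ r k → ∃ (CarryStep r)
  carry {suc a} r k p≤rk = shift (m≤n⇒m<n∨m≡n (toℕ<n k))
    where
    open ≡-Reasoning
    r₁ : Fin (suc a) → ℕ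
    r₁ = updateAt r k (_∸ p)

    ∑-carry : ∀ k⁺ → ∑ r ≡ p′ + ∑ (updateAt r₁ k⁺ suc)
    ∑-carry k⁺ = begin
      ∑ r                           ≡⟨ ∑-updateAt-∸ r k p≤rk ⟩
      suc p′ + ∑ r₁                 ≡⟨ sym (+-suc p′ (∑ r₁)) ⟩
      p′ + suc (∑ r₁)               ≡⟨ cong (p′ +_) (sym (∑-updateAt-suc r₁ k⁺)) ⟩
      p′ + ∑ (updateAt r₁ k⁺ suc)   ∎

    shift : suc (toℕ k) < suc a ⊎ suc (toℕ k) ≡ suc a → ∃ (CarryStep r)
    shift (inj₁ k+1<a) = updateAt r₁ k⁺ suc , ∑-carry k⁺ , inj₁ (begin
      value r                  ≡⟨ value-updateAt-∸ r k p≤rk ⟩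
      p ^ suc (toℕ k) + value r₁ ≡⟨ cong (λ e → p ^ e + value r₁) (sym (toℕ-fromℕ< k+1<a)) ⟩
      p ^ toℕ k⁺ + value r₁      ≡⟨ sym (value-updateAt-suc r₁ k⁺) ⟩
      value (updateAt r₁ k⁺ suc) ∎)
      where
      k⁺ = fromℕ< k+1<a
    -- the unit carried out of the top position re-enters at position 0, lowering the value by q - 1
    shift (inj₂ k+1≡a) = updateAt r₁ zero suc , ∑-carry zero ,
                         inj₂ (value-wrap , subst (q ≤_) (sym wrap) (m≤m+n q (value r₁)))
      where
      q = p ^ suc a
      wrap : value r ≡ q + value r₁
      wrap = trans (value-updateAt-∸ r k p≤rk) (cong (λ e → p ^ e + value r₁) k+1≡a)
      value-wrap : value r ≡ (q ∸ 1) + value (updateAt r₁ zero suc)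
      value-wrap = begin
        value r                     ≡⟨ wrap ⟩
        q + value r₁                ≡⟨ cong (_+ value r₁) (sym (m+[n∸m]≡n (m^n>0 p (suc a)))) ⟩
        suc ((q ∸ 1) + value r₁)    ≡⟨ sym (+-suc (q ∸ 1) (value r₁)) ⟩
        (q ∸ 1) + suc (value r₁)    ≡⟨ cong ((q ∸ 1) +_) (sym (value-updateAt-suc r₁ zero)) ⟩
        (q ∸ 1) + value (updateAt r₁ zero suc) ∎

  digits : ∀ {a} → ℕ → Fin a → ℕ
  digits x k = digit p (toℕ k) x

  digit-zero : ∀ x → digit p 0 x ≡ x % p
  digit-zero x = cong (_% p) (n/1≡n x)

  digit-suc : ∀ k x → digit p (suc k) x ≡ digit p k (x / p)
  digit-suc k x = cong (_% p) (sym (m/n/o≡m/[n*o] x p (p ^ k) {{_}} {{m^n≢0 p k}} {{m^n≢0 p (suc k)}}))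

  value-digits : ∀ {a} x → x < p ^ a → value {a} (digits x) ≡ x
  value-digits {zero}  zero    _    = refl
  value-digits {zero}  (suc x) (s≤s ())
  value-digits {suc a} x     x<pq = begin
    value {suc a} (digits x)                           ≡⟨ value-suc {a} (digits x) ⟩
    digit p 0 x + value {a} (λ k → digit p (suc (toℕ k)) x) * p
      ≡⟨ cong₂ (λ d V → d + V * p) (digit-zero x) (value-cong {a} (λ k → digit-suc (toℕ k) x)) ⟩
    x % p + value {a} (digits (x / p)) * p
      ≡⟨ cong (λ V → x % p + V * p) (value-digits {a} (x / p) (m<n*o⇒m/o<n (subst (x <_) (*-comm p (p ^ a)) x<pq))) ⟩
    x % p + x / p * p                                  ≡⟨ sym (m≡m%n+[m/n]*n x p) ⟩
    x ∎
    where open ≡-Reasoning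

  ∑-digits-suc : ∀ {a} x → ∑ {suc a} (digits x) ≡ x % p + ∑ {a} (digits (x / p))
  ∑-digits-suc {a} x = cong₂ _+_ (digit-zero x) (∑-cong {a} (λ k → digit-suc (toℕ k) x))

  -- c is the carry entering position 0; each position emits (c + r k) / p to the next one
  ∑-digits-≤ : ∀ {a} c (r : Fin a → ℕ) → ∑ {a} (digits (c + value r)) ≤ c + ∑ r
  ∑-digits-≤ {zero}  c r = z≤n
  ∑-digits-≤ {suc a} c r = begin
    ∑ {suc a} (digits (c + value r))
      ≡⟨ cong (∑ {suc a} ∘ digits) (trans (cong (c +_) (value-suc {a} r)) (sym (+-assoc c (r zero) (V * p)))) ⟩
    ∑ {suc a} (digits (m + V * p))       ≡⟨ ∑-digits-suc {a} (m + V * p) ⟩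
    (m + V * p) % p + ∑ {a} (digits ((m + V * p) / p))
      ≡⟨ cong₂ (λ d x → d + ∑ {a} (digits x)) ([m+kn]%n≡m%n m V p) div-step ⟩
    m % p + ∑ {a} (digits (m / p + V))   ≤⟨ +-monoʳ-≤ (m % p) (∑-digits-≤ (m / p) (λ k → r (suc k))) ⟩
    m % p + (m / p + R)                  ≡⟨ sym (+-assoc (m % p) (m / p) R) ⟩
    (m % p + m / p) + R                  ≤⟨ +-monoˡ-≤ R m%p+m/p≤m ⟩
    m + R                                ≡⟨ +-assoc c (r zero) R ⟩
    c + ∑ r ∎
    where
    open ≤-Reasoning
    m = c + r zero
    V = value {a} (λ k → r (suc k))
    R = ∑ (λ k → r (suc k))
    div-step : (m + V * p) / p ≡ m / p + V
    div-step = trans (+-distrib-/-∣ʳ m (n∣m*n V)) (cong (m / p +_) (m*n/n≡m V p))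
    m%p+m/p≤m : m % p + m / p ≤ m
    m%p+m/p≤m = ≤-trans (+-monoʳ-≤ (m % p) (m≤m*n (m / p) p)) (≤-reflexive (sym (m≡m%n+[m/n]*n m p)))

module Reduction (P : ℕ) {n N : ℕ} (A : Fin N → Vec ℤ n) (M : Vec ℤ n → Set) (a : ℕ)
                 (closed : MClosed A (suc (suc P) ^ a) M) where

  open Positional (suc P)

  -- Unlike digits, the entries t i k may exceed p - 1.
  Tokens : Set
  Tokens = Fin N → Fin a → ℕ

  count : Tokens → ℕ
  count t = ∑ (λ i → ∑ (t i))

  values : Tokens → Fin N → ℕ
  values t i = value (t i)

  carry-step : ∀ t i k → p ≤ t i k → M (lin A (values t)) →
               ∃ λ t′ → count t′ < count t × M (lin A (values t′))
  carry-step t i k p≤tik Mt with carry (t i) k p≤tik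
  ... | r′ , ∑-shift , value-shift = t′ , count-shrinks , M-preserved value-shift
    where
    t′ : Tokens
    t′ = updateAt t i (λ _ → r′)
    t′-off-i : ∀ j → j ≢ i → t j ≡ t′ j
    t′-off-i j j≢i = sym (updateAt-minimal j i t j≢i)
    t′-at-i : r′ ≡ t′ i
    t′-at-i = sym (updateAt-updates i t)
    count-shift : count t ≡ suc P + count t′
    count-shift = ∑-incr i (λ j j≢i → cong ∑ (t′-off-i j j≢i))
                           (trans ∑-shift (cong (λ r → suc P + ∑ r) t′-at-i))
    count-shrinks : count t′ < count t
    count-shrinks = subst (count t′ <_) (sym count-shift) (s≤s (m≤n+m (count t′) P))
    M-preserved : value (t i) ≡ value r′ ⊎ value (t i) ≡ (p ^ a ∸ 1) + value r′ × p ^ a ≤ value (t i) →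
                  M (lin A (values t′))
    M-preserved (inj₁ same) = subst M (lin-cong A λ j → sym (begin
      values t′ j
        ≡⟨ map-updateAt-local {f = value} {g = λ _ → r′} {h = λ x → x} t i (sym same) j ⟩
      updateAt (values t) i (λ x → x) j  ≡⟨ updateAt-id i (values t) j ⟩
      values t j                       ∎)) Mt
      where open ≡-Reasoning
    M-preserved (inj₂ (wrapped , q≤)) = subst M
      (lin-incr A i (λ j j≢i → cong value (t′-off-i j j≢i))
                    (trans wrapped (cong (λ r → (p ^ a ∸ 1) + value r) t′-at-i)))
      (closed _ Mt (values t) refl i q≤)

  reduce-acc : ∀ t → Acc _<_ (count t) → M (lin A (values t)) →
               ∃ λ u → InUM A p a M u × wp A p a u ≤ count t
  reduce-acc t (acc rec) Mt with any? (λ i → any? (λ k → p ≤? t i k))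
  ... | yes (i , k , p≤tik) with carry-step t i k p≤tik Mt
  ...   | t′ , t′<t , Mt′ with reduce-acc t′ (rec t′<t) Mt′
  ...     | u , u∈UM , wp≤ = u , u∈UM , ≤-trans wp≤ (<⇒≤ t′<t)
  reduce-acc t _ Mt | no no-big-entry = values t , (in-box , Mt) , ∑-mono-≤ (λ i → ∑-digits-≤ 0 (t i))
    where
    in-box : InBox A (p ^ a) (values t)
    in-box i = <⇒≤pred (value-< (t i) (λ k → ≰⇒> (λ p≤tik → no-big-entry (i , k , p≤tik))))

  reduce : ∀ t → M (lin A (values t)) → ∃ λ u → InUM A p a M u × wp A p a u ≤ count t
  reduce t = reduce-acc t (<-wellFounded (count t))

  reduce-< : ∀ t i k → p ≤ t i k → M (lin A (values t)) → ∃ λ u → InUM A p a M u × wp A p a u < count t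
  reduce-< t i k p≤tik Mt with carry-step t i k p≤tik Mt
  ... | t′ , t′<t , Mt′ with reduce t′ Mt′
  ...   | u , u∈UM , wp≤ = u , u∈UM , ≤-<-trans wp≤ t′<t

  module Column (u : Fin N → ℕ) (u-min : InUMmin A p a M u) (κ : Fin a) where

    uDigits : Tokens
    uDigits i = digits (u i)

    column : Fin N → ℕ
    column i = digit p (toℕ κ) (u i)

    replace : (Fin N → ℕ) → Tokens
    replace v i = updateAt (uDigits i) κ (λ _ → v i)

    erased : Tokens
    erased = replace (λ _ → 0)

    split : ∀ i (r : Fin a → ℕ) {m} → (∀ k → k ≢ κ → r k ≡ uDigits i k) → r κ ≡ m →
            ∑ r ≡ m + ∑ (erased i) × value r ≡ m * p ^ toℕ κ + value (erased i)
    split i r {m} agree rκ≡m = ∑-incr κ agree-erased rκ , value-incr κ agree-erased rκ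
      where
      agree-erased : ∀ k → k ≢ κ → r k ≡ erased i k
      agree-erased k k≢κ = trans (agree k k≢κ) (sym (updateAt-minimal k κ (uDigits i) k≢κ))
      rκ : r κ ≡ m + erased i κ
      rκ = trans rκ≡m (trans (sym (+-identityʳ m)) (cong (m +_) (sym (updateAt-updates κ (uDigits i)))))

    split-u : ∀ i → ∑ (uDigits i) ≡ column i + ∑ (erased i) ×
                    value (uDigits i) ≡ column i * p ^ toℕ κ + value (erased i)
    split-u i = split i (uDigits i) (λ _ _ → refl) refl

    split-replace : ∀ v i → ∑ (replace v i) ≡ v i + ∑ (erased i) ×
                            value (replace v i) ≡ v i * p ^ toℕ κ + value (erased i)
    split-replace v i = split i (replace v i) (λ k k≢κ → updateAt-minimal k κ (uDigits i) k≢κ)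
                                              (updateAt-updates κ (uDigits i))

    wp-u : wp A p a u ≡ size A column + count erased
    wp-u = trans (∑-cong (λ i → proj₁ (split-u i))) (∑-distrib-+ column (λ i → ∑ (erased i)))

    count-replace : ∀ v → count (replace v) ≡ size A v + count erased
    count-replace v = trans (∑-cong (λ i → proj₁ (split-replace v i))) (∑-distrib-+ v (λ i → ∑ (erased i)))

    replace-admissible : ∀ v → lin A v ≡ lin A column → M (lin A (values (replace v)))
    replace-admissible v lin-v = subst M lin-u≡ (proj₂ (proj₁ u-min))
      where
      open ≡-Reasoning
      w = p ^ toℕ κ
      u<q : ∀ i → u i < p ^ a
      u<q i = m≤pred[n]⇒suc[m]≤n {{m^n≢0 p a}} (proj₁ (proj₁ u-min) i)
      lin-u≡ : lin A u ≡ lin A (values (replace v))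
      lin-u≡ = begin
        lin A u
          ≡⟨ lin-cong A (λ i → trans (sym (value-digits {a} (u i) (u<q i))) (proj₂ (split-u i))) ⟩
        lin A (λ i → column i * w + value (erased i))
          ≡⟨ lin-affine-cong A w {column} {v} (values erased) (sym lin-v) ⟩
        lin A (λ i → v i * w + value (erased i))
          ≡⟨ lin-cong A (λ i → sym (proj₂ (split-replace v i))) ⟩
        lin A (values (replace v)) ∎

    wp-u-≤ : ∀ t → M (lin A (values t)) → wp A p a u ≤ count t
    wp-u-≤ t Mt with reduce t Mt
    ... | u′ , u′∈UM , wp≤ = ≤-trans (proj₂ u-min u′ u′∈UM) wp≤

    column-minimal : ∀ v → InU⁺ A (lin A column) v → size A column ≤ size A v
    column-minimal v lin-v = +-cancelʳ-≤ (count erased) _ _ (begin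
      size A column + count erased  ≡⟨ wp-u ⟨
      wp A p a u                    ≤⟨ wp-u-≤ (replace v) (replace-admissible v lin-v) ⟩
      count (replace v)             ≡⟨ count-replace v ⟩
      size A v + count erased       ∎)
      where open ≤-Reasoning

    column-good : Good A p (lin A column)
    column-good w (lin-w , w-minimal) i with p ≤? w i
    ... | no  p≰wi = <⇒≤pred (≰⇒> p≰wi)
    ... | yes p≤wi with reduce-< (replace w) i κ (subst (p ≤_) (sym (updateAt-updates κ (uDigits i))) p≤wi)
                                 (replace-admissible w lin-w)
    ...   | u′ , u′∈UM , wp< = ⊥-elim (<-irrefl refl (begin-strict
      wp A p a u                    ≤⟨ proj₂ u-min u′ u′∈UM ⟩
      wp A p a u′                   <⟨ wp< ⟩
      count (replace w)             ≡⟨ count-replace w ⟩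
      size A w + count erased       ≤⟨ +-monoˡ-≤ (count erased) (w-minimal column refl) ⟩
      size A column + count erased  ≡⟨ wp-u ⟨
      wp A p a u                    ∎))
      where open ≤-Reasoning

proposition5p6 : (p a : ℕ) → Prime p → 1 ≤ a →
    (n N : ℕ) (A : Fin N → Vec ℤ n) (M : Vec ℤ n → Set) →
    MClosed A (p ^ a) M →
    ∃ (λ u → InUM A p a M u) →
    (u : Fin N → ℕ) → InUMmin A p a M u →
    (k : ℕ) → k < a →
    Good A p (lin A (λ i → digit p k (u i)))
      × InU⁺min A (lin A (λ i → digit p k (u i))) (λ i → digit p k (u i))
proposition5p6 zero          _ 0-prime = contradiction 0-prime ¬prime[0]
proposition5p6 (suc zero)    _ 1-prime = contradiction 1-prime ¬prime[1]
proposition5p6 (suc (suc P)) a _ _ n N A M closed _ u u-min k k<a =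
  subst (λ m → Good A p (lin A (digitsAt m)) × InU⁺min A (lin A (digitsAt m)) (digitsAt m))
        (toℕ-fromℕ< k<a)
        (column-good , refl , column-minimal)
  where
  p = suc (suc P)
  digitsAt : ℕ → Fin N → ℕ
  digitsAt m i = digit p m (u i)
  open Reduction.Column P A M a closed u u-min (fromℕ< k<a)
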